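{- Let $r\geq 1$ and $k\geq 2$ be integers, and let $\ell_0=\left\lceil \max\left\{\sqrt{\tfrac{k}{2}+1},\ \tfrac{k-1}{r}+2\right\}\right\rceil$. Then for every integer $\ell\geq \ell_0^2$, $rc_k(K_{\ell[r]})=2$.
   Context: For integers $m\geq 1$ and $r\geq 1$, $K_{m[r]}$ denotes the complete $m$-partite graph in which each of the $m$ parts has exactly $r$ vertices. In an edge-colored graph (adjacent edges may receive the same color), a path is rainbow if no two of its edges have the same color. For a $\kappa$-connected graph $G$ and an integer $k$ with $1\leq k\leq\kappa$, the rainbow $k$-connectivity $rc_k(G)$ is the minimum integer $j$ such that there is an edge-coloring of $G$ with $j$ colors in which every two distinct vertices $u,v$ are connected by at least $k$ internally disjoint rainbow $u$–$v$ paths. -}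

module Defs where

open import Data.Nat using (ℕ; zero; suc; _+_; _*_; _∸_; _≤_; _<_; _⊔_; _≤?_)
open import Data.Fin using (Fin)
open import Data.Product using (_×_; _,_; Σ; ∃)
open import Data.List using (List; []; _∷_; _++_)
open import Data.List.Relation.Unary.Linked using (Linked; []; [-]; _∷_)
open import Data.List.Relation.Unary.Unique.Propositional using (Unique)
open import Data.List.Membership.Propositional using (_∈_)
open import Data.Empty using (⊥)
open import Relation.Nullary using (¬_; Dec; yes; no)
open import Relation.Binary.PropositionalEquality using (_≡_; _≢_)

module _ {V : Set} (Adj : V → V → Set) where

  record EdgeColouring (j : ℕ) : Set where
    field
      colour : (u v : V) → Adj u v → Fin j
      symm   : ∀ u v (p : Adj u v) (q : Adj v u) → colour u v p ≡ colour v u q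
  open EdgeColouring public

  edgeColours : ∀ {j} → EdgeColouring j → {xs : List V} → Linked Adj xs → List (Fin j)
  edgeColours c []        = []
  edgeColours c [-]       = []
  edgeColours c (_∷_ {x} {y} e l) = colour c x y e ∷ edgeColours c l

  RainbowPath : ∀ {j} → EdgeColouring j → V → V → List V → Set
  RainbowPath c u v mid =
    Σ (Linked Adj (u ∷ mid ++ v ∷ [])) λ L →
      Unique (u ∷ mid ++ v ∷ []) × Unique (edgeColours c L)

  RainbowKConnected : ∀ {j} → EdgeColouring j → ℕ → Set
  RainbowKConnected c k =
    ∀ u v → u ≢ v →
      Σ (Fin k → List V) λ P →
        (∀ i → RainbowPath c u v (P i)) ×
        (∀ i i′ → i ≢ i′ → (P i ≢ P i′) × (∀ x → x ∈ P i → x ∈ P i′ → ⊥))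

  RcEquals : ℕ → ℕ → Set
  RcEquals k j =
    (Σ (EdgeColouring j) λ c → RainbowKConnected c k) ×
    (∀ j′ → j′ < j → ¬ (Σ (EdgeColouring j′) λ c → RainbowKConnected c k))

-- The complete ℓ-partite graph K_{ℓ[r]}: vertices (part , index),
-- two vertices adjacent iff they lie in different parts.

KV : ℕ → ℕ → Set
KV ℓ r = Fin ℓ × Fin r

KAdj : (ℓ r : ℕ) → KV ℓ r → KV ℓ r → Set
KAdj ℓ r (i , a) (j , b) = i ≢ j

leastFrom : (P : ℕ → Set) → (∀ n → Dec (P n)) → ℕ → ℕ → ℕ
leastFrom P P? zero    n = n
leastFrom P P? (suc f) n with P? n
... | yes _ = n
... | no  _ = leastFrom P P? f (suc n)

-- least n ≥ 0 with P n, provided P bound holds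
least : (P : ℕ → Set) → (∀ n → Dec (P n)) → ℕ → ℕ
least P P? bound = leastFrom P P? bound 0

-- ⌈ √(k/2 + 1) ⌉ = least n with n² ≥ k/2 + 1, i.e. 2n² ≥ k + 2
ceilSqrtHalfPlusOne : ℕ → ℕ
ceilSqrtHalfPlusOne k = least (λ n → k + 2 ≤ 2 * (n * n)) (λ n → k + 2 ≤? 2 * (n * n)) (k + 2)

-- ⌈ m / r ⌉ for r ≥ 1 = least n with m ≤ r n
ceilDiv : ℕ → ℕ → ℕ
ceilDiv m r = least (λ n → m ≤ r * n) (λ n → m ≤? r * n) m

-- ℓ₀ = ⌈ max { √(k/2+1) , (k-1)/r + 2 } ⌉
--    = max { ⌈√(k/2+1)⌉ , ⌈(k-1)/r⌉ + 2 }
ℓ₀ : ℕ → ℕ → ℕ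
ℓ₀ k r = ceilSqrtHalfPlusOne k ⊔ (ceilDiv (k ∸ 1) r + 2)

module Submission where

-- Lay the ℓ ≥ L² parts of K_{ℓ[r]} out in a grid with L = ℓ₀ columns and let h be its rook's
-- graph (two parts are h-adjacent when they share a row or a column). Colour the edge between
-- (i , a) and (j , b) by [a = b] xor h i j. A vertex (m , c) is then the middle of a rainbow path
-- of length two from (i , a) to (j , b) exactly when [a = c] xor [c = b] differs from
-- h i m xor h m j. In the rook's graph any two parts have at least L − 2 other parts adjacent to
-- exactly one of them and at least L − 2 adjacent to neither, so every index c contributes L − 2
-- middles: together with the edge itself this gives 1 + r (L − 2) ≥ k internally disjoint rainbow
-- paths between different parts, and 2 (ℓ − 1) ≥ k between two vertices of the same part.
-- Fewer than two colours never suffice, as every rainbow path would then be a single edge.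

open import Defs
open import Data.Bool using (Bool; true; false; _∨_; _xor_)
open import Data.Bool.Properties using (not-injective; not-¬; ∨-zeroʳ) renaming (_≟_ to _≟ᵇ_)
open import Data.Empty using (⊥; ⊥-elim)
open import Data.Fin using (Fin; zero; suc; toℕ; fromℕ<; inject≤; punchIn; remQuot; combine; _≟_)
open import Data.Fin.Properties
  using (toℕ-injective; toℕ-fromℕ<; toℕ<n; inject≤-injective; punchIn-injective; punchInᵢ≢i;
         combine-remQuot; 2↔Bool)
open import Data.List using (List; []; _∷_)
open import Data.List.Properties using (∷-injectiveˡ)
open import Data.List.Relation.Unary.Linked using ([-]; _∷_)
open import Data.List.Relation.Unary.AllPairs using ([]; _∷_)
open import Data.List.Relation.Unary.All using ([]; _∷_)
open import Data.List.Relation.Unary.Any using (here)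
open import Data.List.Membership.Propositional using (_∈_)
open import Data.Nat
  using (ℕ; zero; suc; _+_; _*_; _∸_; _≤_; _<_; _⊔_; _⊓_; s≤s; z≤n; _≤?_; _<?_; NonZero; >-nonZero)
open import Data.Nat.Properties
  using (≤-refl; ≤-trans; ≤-total; ≤-pred; ≰⇒>; <⇒≱; <⇒≢; ≮⇒≥; ≤⇒≯; n≮n; ≤-<-trans; <-cmp;
         n≤1+n; m≤n+m; m≤n+m∸n; n≢0⇒n>0; suc-injective; +-suc; +-identityʳ; *-comm; *-zeroʳ;
         +-monoˡ-≤; +-monoˡ-<; *-mono-≤; *-monoʳ-≤; *-monoˡ-≤; ∸-monoˡ-≤; m+n∸n≡m; *-distribʳ-∸;
         m≤m*n; m≤n*m; m≤n⇒m≤o*n; m≤m⊔n; m≤n⊔m; m⊓n≤m⊔n; m≤n⇒m⊓n≡m; m≥n⇒m⊔n≡m; ⊔-comm; ⊓-comm;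
         module ≤-Reasoning)
  renaming (_≟_ to _≟ℕ_)
open import Data.Nat.DivMod
open import Data.Nat.Divisibility using (n∣m*n)
open import Data.Product using (_×_; _,_; Σ; proj₁; proj₂; uncurry)
open import Data.Sum using (_⊎_; inj₁; inj₂)
open import Data.Unit using (⊤; tt)
open import Function using (_∘_; Injective)
open import Function.Bundles using (Injection; _↣_)
open import Function.Properties.Inverse using (↔-sym; Inverse⇒Injection)
open import Relation.Nullary using (yes; no; does; contradiction)
open import Relation.Nullary.Decidable using (dec-true; dec-false)
open import Relation.Binary.PropositionalEquality
open import Relation.Binary.Definitions using (DecidableEquality; tri<; tri≈; tri>)

-- Injective families

record AtLeast {A : Set} (N : ℕ) (P : A → Set) : Set where
  field
    pick           : Fin N → A
    pick-injective : Injective _≡_ _≡_ pick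
    pick-satisfies : ∀ t → P (pick t)
open AtLeast

remQuot-injective : ∀ {n} k → Injective _≡_ _≡_ (remQuot {n} k)
remQuot-injective {n} k {s} {t} e = begin
  s                                  ≡⟨ combine-remQuot {n} k s ⟨
  uncurry combine (remQuot {n} k s)  ≡⟨ cong (uncurry combine) e ⟩
  uncurry combine (remQuot {n} k t)  ≡⟨ combine-remQuot {n} k t ⟩
  t                                  ∎
  where open ≡-Reasoning

module _ {A : Set} where

  AtLeast-map : ∀ {N} {P Q : A → Set} → (∀ {x} → P x → Q x) → AtLeast N P → AtLeast N Q
  AtLeast-map P⇒Q S = record
    { pick = pick S ; pick-injective = pick-injective S ; pick-satisfies = P⇒Q ∘ pick-satisfies S }

  AtLeast-pair : ∀ {x y : A} → x ≢ y → AtLeast 2 (λ z → z ≡ x ⊎ z ≡ y)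
  AtLeast-pair {x} {y} x≢y = record
    { pick = λ { zero → x ; (suc zero) → y }
    ; pick-injective = λ { {zero} {zero} _ → refl ; {suc zero} {suc zero} _ → refl
                         ; {zero} {suc zero} e → ⊥-elim (x≢y e) ; {suc zero} {zero} e → ⊥-elim (x≢y (sym e)) }
    ; pick-satisfies = λ { zero → inj₁ refl ; (suc zero) → inj₂ refl }
    }

  AtLeast-× : ∀ {B : Set} {M N} {Q : B → Set} {P : A → B → Set} →
              AtLeast M Q → (∀ {b} → Q b → AtLeast N (λ a → P a b)) →
              AtLeast (N * M) (uncurry P)
  AtLeast-× {B} {M} {N} {P = P} outer inner = record
    { pick           = pickPair ∘ remQuot {N} M
    ; pick-injective = remQuot-injective M ∘ pickPair-injective
    ; pick-satisfies = λ s → pick-satisfies (inner′ (proj₂ (remQuot {N} M s))) (proj₁ (remQuot {N} M s))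
    }
    where
    inner′ : ∀ c → AtLeast N (λ a → P a (pick outer c))
    inner′ c = inner (pick-satisfies outer c)
    pickPair : Fin N × Fin M → A × B
    pickPair (t , c) = pick (inner′ c) t , pick outer c
    pickPair-injective : Injective _≡_ _≡_ pickPair
    pickPair-injective {t , c} {t′ , c′} e with refl ← pick-injective outer (cong proj₂ e) =
      cong (_, c) (pick-injective (inner′ c) (cong proj₁ e))

AtLeast-Fin : ∀ {n} → AtLeast n (λ (_ : Fin n) → ⊤)
AtLeast-Fin = record { pick = λ t → t ; pick-injective = λ e → e ; pick-satisfies = λ _ → tt }

AtLeast-≢ : ∀ {ℓ} (i : Fin ℓ) → AtLeast (ℓ ∸ 1) (_≢ i)
AtLeast-≢ {suc _} i = record
  { pick = punchIn i ; pick-injective = punchIn-injective i _ _ ; pick-satisfies = punchInᵢ≢i i }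

punchInℕ : ℕ → ℕ → ℕ
punchInℕ x v with v <? x
... | yes _ = v
... | no  _ = suc v

punchInℕ-≢ : ∀ x v → punchInℕ x v ≢ x
punchInℕ-≢ x v with v <? x
... | yes v<x = <⇒≢ v<x
... | no  v≮x = λ { refl → v≮x ≤-refl }

punchInℕ-≢-below : ∀ x v {y} → y ≤ x → v ≢ y → punchInℕ x v ≢ y
punchInℕ-≢-below x v y≤x v≢y with v <? x
... | yes _   = v≢y
... | no  v≮x = λ { refl → contradiction (≤-trans y≤x (≮⇒≥ v≮x)) (n≮n v) }

punchInℕ-injective : ∀ x → Injective _≡_ _≡_ (punchInℕ x)
punchInℕ-injective x {v} {w} e with v <? x | w <? x
... | yes _   | yes _   = e
... | no  _   | no  _   = suc-injective e
... | yes v<x | no  w≮x = contradiction (subst (_< x) e v<x) (≤⇒≯ (≤-trans (≮⇒≥ w≮x) (n≤1+n w)))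
... | no  v≮x | yes w<x = contradiction (subst (_< x) (sym e) w<x) (≤⇒≯ (≤-trans (≮⇒≥ v≮x) (n≤1+n v)))

punchInℕ-≤ : ∀ x v → punchInℕ x v ≤ suc v
punchInℕ-≤ x v with v <? x
... | yes _ = n≤1+n v
... | no  _ = ≤-refl

-- Punching in the larger value last cannot land on the smaller one (punchInℕ-≢-below).
avoid₂ : ℕ → ℕ → ℕ → ℕ
avoid₂ x y = punchInℕ (x ⊔ y) ∘ punchInℕ (x ⊓ y)

avoid₂-injective : ∀ x y → Injective _≡_ _≡_ (avoid₂ x y)
avoid₂-injective x y = punchInℕ-injective (x ⊓ y) ∘ punchInℕ-injective (x ⊔ y)

avoid₂-≤ : ∀ x y t → avoid₂ x y t ≤ 2 + t
avoid₂-≤ x y t = ≤-trans (punchInℕ-≤ (x ⊔ y) _) (s≤s (punchInℕ-≤ (x ⊓ y) t))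

avoid₂-≢⊓ : ∀ x y t → avoid₂ x y t ≢ x ⊓ y
avoid₂-≢⊓ x y t = punchInℕ-≢-below (x ⊔ y) _ (m⊓n≤m⊔n x y) (punchInℕ-≢ (x ⊓ y) t)

avoid₂-≢ˡ : ∀ x y t → avoid₂ x y t ≢ x
avoid₂-≢ˡ x y t with ≤-total x y
... | inj₁ x≤y = subst (avoid₂ x y t ≢_) (m≤n⇒m⊓n≡m x≤y) (avoid₂-≢⊓ x y t)
... | inj₂ y≤x = subst (avoid₂ x y t ≢_) (m≥n⇒m⊔n≡m y≤x) (punchInℕ-≢ (x ⊔ y) _)

avoid₂-comm : ∀ x y t → avoid₂ x y t ≡ avoid₂ y x t
avoid₂-comm x y t = cong₂ (λ hi lo → punchInℕ hi (punchInℕ lo t)) (⊔-comm x y) (⊓-comm x y)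

avoid₂-≢ʳ : ∀ x y t → avoid₂ x y t ≢ y
avoid₂-≢ʳ x y t = avoid₂-≢ˡ y x t ∘ trans (sym (avoid₂-comm x y t))

-- Rainbow paths

Fin≤1-trivial : ∀ {j} → j ≤ 1 → (x y : Fin j) → x ≡ y
Fin≤1-trivial {1}           _        zero zero = refl
Fin≤1-trivial {suc (suc _)} (s≤s ()) _    _

module _ {V : Set} {Adj : V → V → Set} where

  RainbowPaths : ∀ {j} → EdgeColouring Adj j → ℕ → V → V → Set
  RainbowPaths c k u v =
    Σ (Fin k → List V) λ P →
      (∀ i → RainbowPath Adj c u v (P i)) ×
      (∀ i i′ → i ≢ i′ → (P i ≢ P i′) × (∀ x → x ∈ P i → x ∈ P i′ → ⊥))

  rainbow-noInterior : ∀ {j} {c : EdgeColouring Adj j} {u v mid} → j ≤ 1 →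
                       RainbowPath Adj c u v mid → mid ≡ []
  rainbow-noInterior {mid = []} _ _ = refl
  rainbow-noInterior {mid = _ ∷ []}    j≤1 (_ ∷ _ ∷ _ , _ , (c₁≢c₂ ∷ _) ∷ _) =
    ⊥-elim (c₁≢c₂ (Fin≤1-trivial j≤1 _ _))
  rainbow-noInterior {mid = _ ∷ _ ∷ _} j≤1 (_ ∷ _ ∷ _ , _ , (c₁≢c₂ ∷ _) ∷ _) =
    ⊥-elim (c₁≢c₂ (Fin≤1-trivial j≤1 _ _))

  RainbowPaths-mono : ∀ {j k k′} {c : EdgeColouring Adj j} {u v} → k ≤ k′ →
                     RainbowPaths c k′ u v → RainbowPaths c k u v
  RainbowPaths-mono k≤k′ (P , rainbow , disjoint) =
    P ∘ inject≤′ , rainbow ∘ inject≤′ ,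
    λ t t′ t≢t′ → disjoint (inject≤′ t) (inject≤′ t′) (t≢t′ ∘ inject≤-injective k≤k′ k≤k′ t t′)
    where inject≤′ = λ t → inject≤ t k≤k′

  rainbowConnected⇒2≤colours : ∀ {j k} {u v : V} → u ≢ v → 2 ≤ k →
                               (c : EdgeColouring Adj j) → RainbowKConnected Adj c k → 2 ≤ j
  rainbowConnected⇒2≤colours {j} u≢v (s≤s (s≤s _)) c connected with 2 ≤? j | connected _ _ u≢v
  ... | yes 2≤j | _ = 2≤j
  ... | no  2≰j | P , rainbow , disjoint =
    ⊥-elim (proj₁ (disjoint zero (suc zero) λ ()) (trans (direct zero) (sym (direct (suc zero)))))
    where
    direct : ∀ i → P i ≡ []
    direct i = rainbow-noInterior (≤-pred (≰⇒> 2≰j)) (rainbow i)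

  module _ (adj⇒≢ : ∀ {u v} → Adj u v → u ≢ v) {j} (c : EdgeColouring Adj j) where

    RainbowMiddle : V → V → V → Set
    RainbowMiddle u v w = Σ (Adj u w) λ e → Σ (Adj w v) λ e′ → colour c u w e ≢ colour c w v e′

    rainbowEdge : ∀ {u v} → Adj u v → RainbowPath Adj c u v []
    rainbowEdge e = e ∷ [-] , (adj⇒≢ e ∷ []) ∷ [] ∷ [] , [] ∷ []

    rainbowThrough : ∀ {u v w} → u ≢ v → RainbowMiddle u v w → RainbowPath Adj c u v (w ∷ [])
    rainbowThrough u≢v (e , e′ , c≢c′) =
      e ∷ e′ ∷ [-] , (adj⇒≢ e ∷ u≢v ∷ []) ∷ (adj⇒≢ e′ ∷ []) ∷ [] ∷ [] , (c≢c′ ∷ []) ∷ [] ∷ []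

    pathsThrough : ∀ {k u v} → u ≢ v → AtLeast k (RainbowMiddle u v) → RainbowPaths c k u v
    pathsThrough u≢v S =
      (λ t → pick S t ∷ []) ,
      (λ t → rainbowThrough u≢v (pick-satisfies S t)) ,
      λ t t′ t≢t′ → (t≢t′ ∘ pick-injective S ∘ ∷-injectiveˡ) ,
                    λ { x (here refl) (here e) → t≢t′ (pick-injective S e) }

    pathsThroughAndEdge : ∀ {k u v} → Adj u v → AtLeast k (RainbowMiddle u v) →
                          RainbowPaths c (suc k) u v
    pathsThroughAndEdge e S = P , rainbow , disjoint
      where
      P : Fin _ → List V
      P zero    = []
      P (suc t) = pick S t ∷ []
      rainbow : ∀ t → RainbowPath Adj c _ _ (P t)
      rainbow zero    = rainbowEdge e
      rainbow (suc t) = rainbowThrough (adj⇒≢ e) (pick-satisfies S t)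
      disjoint : ∀ t t′ → t ≢ t′ → (P t ≢ P t′) × (∀ x → x ∈ P t → x ∈ P t′ → ⊥)
      disjoint zero    zero     0≢0   = ⊥-elim (0≢0 refl)
      disjoint zero    (suc _)  _     = (λ ()) , λ _ ()
      disjoint (suc _) zero     _     = (λ ()) , λ _ _ ()
      disjoint (suc t) (suc t′) t≢t′ = proj₂ (proj₂ (pathsThrough (adj⇒≢ e) S)) t t′ (t≢t′ ∘ cong suc)

-- Complete multipartite graphs

xor-≢ : ∀ {p q x y} → (p ≡ q → x ≢ y) → (p ≢ q → x ≡ y) → p xor x ≢ q xor y
xor-≢ {false} {false} same⇒≢ _ = same⇒≢ refl
xor-≢ {true}  {true}  same⇒≢ _ = same⇒≢ refl ∘ not-injective
xor-≢ {false} {true}  _ diff⇒≡ = not-¬ (diff⇒≡ λ ())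
xor-≢ {true}  {false} _ diff⇒≡ = not-¬ (sym (diff⇒≡ λ ())) ∘ sym

does-≟-sym : ∀ {A : Set} (_≟_ : DecidableEquality A) (a b : A) → does (a ≟ b) ≡ does (b ≟ a)
does-≟-sym _≟_ a b with a ≟ b
... | yes refl = sym (dec-true (a ≟ a) refl)
... | no  a≢b  = sym (dec-false (b ≟ a) (a≢b ∘ sym))

endpoints-≟-differ : ∀ {n} {a b c : Fin n} → a ≢ b → c ≡ a ⊎ c ≡ b → does (a ≟ c) ≢ does (c ≟ b)
endpoints-≟-differ {a = a} {b} a≢b (inj₁ refl) rewrite dec-true (a ≟ a) refl | dec-false (a ≟ b) a≢b = λ ()
endpoints-≟-differ {a = a} {b} a≢b (inj₂ refl) rewrite dec-true (b ≟ b) refl | dec-false (a ≟ b) a≢b = λ ()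

bool↣Fin2 : Bool ↣ Fin 2
bool↣Fin2 = Inverse⇒Injection (↔-sym 2↔Bool)

record Separating {ℓ} (h : Fin ℓ → Fin ℓ → Bool) (K : ℕ) : Set where
  field
    distinguishing : ∀ {i j} → i ≢ j → AtLeast K (λ m → m ≢ i × m ≢ j × h m i ≢ h m j)
    agreeing       : ∀ {i j} → i ≢ j → AtLeast K (λ m → m ≢ i × m ≢ j × h m i ≡ h m j)

module Multipartite {ℓ r : ℕ} (h : Fin ℓ → Fin ℓ → Bool) (h-sym : ∀ i j → h i j ≡ h j i) where

  colourBit : KV ℓ r → KV ℓ r → Bool
  colourBit (i , a) (j , b) = does (a ≟ b) xor h i j

  colouring : EdgeColouring (KAdj ℓ r) 2
  colouring = record
    { colour = λ u v _ → Injection.to bool↣Fin2 (colourBit u v)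
    ; symm   = λ { (i , a) (j , b) _ _ →
                   cong₂ (λ x y → Injection.to bool↣Fin2 (x xor y)) (does-≟-sym _≟_ a b) (h-sym i j) }
    }

  adj⇒≢ : ∀ {u v} → KAdj ℓ r u v → u ≢ v
  adj⇒≢ i≢j = i≢j ∘ cong proj₁

  middle : ∀ {i j m a b c} → m ≢ i → m ≢ j →
           (does (a ≟ c) ≡ does (c ≟ b) → h m i ≢ h m j) →
           (does (a ≟ c) ≢ does (c ≟ b) → h m i ≡ h m j) →
           RainbowMiddle adj⇒≢ colouring (i , a) (j , b) (m , c)
  middle {i} {m = m} m≢i m≢j same⇒≢ diff⇒≡ =
    m≢i ∘ sym , m≢j ,
    xor-≢ (λ same → same⇒≢ same ∘ trans (h-sym m i)) (λ diff → trans (h-sym i m) (diff⇒≡ diff))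
      ∘ Injection.injective bool↣Fin2

  samePartMiddles : ∀ {i a b} → a ≢ b →
                    AtLeast ((ℓ ∸ 1) * 2) (RainbowMiddle adj⇒≢ colouring (i , a) (i , b))
  samePartMiddles {i} {a} {b} a≢b =
    AtLeast-× (AtLeast-pair a≢b) λ {c} c∈ab →
      AtLeast-map (λ m≢i → middle {a = a} {b} {c} m≢i m≢i
                             (⊥-elim ∘ endpoints-≟-differ a≢b c∈ab) (λ _ → refl))
                  (AtLeast-≢ i)

  differentPartMiddles : ∀ {K i j a b} → Separating h K → i ≢ j →
                         AtLeast (K * r) (RainbowMiddle adj⇒≢ colouring (i , a) (j , b))
  differentPartMiddles {i = i} {j} {a} {b} S i≢j = AtLeast-× AtLeast-Fin λ {c} _ → middlesIn c
    where
    open Separating S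
    middlesIn : ∀ c → AtLeast _ (λ m → RainbowMiddle adj⇒≢ colouring (i , a) (j , b) (m , c))
    middlesIn c with does (a ≟ c) ≟ᵇ does (c ≟ b)
    ... | yes same = AtLeast-map (λ (m≢i , m≢j , separates) → middle {a = a} {b} {c} m≢i m≢j
                                   (λ _ → separates) (λ diff → ⊥-elim (diff same)))
                                 (distinguishing i≢j)
    ... | no  diff = AtLeast-map (λ (m≢i , m≢j , agrees) → middle {a = a} {b} {c} m≢i m≢j
                                   (⊥-elim ∘ diff) (λ _ → agrees))
                                 (agreeing i≢j)

  rainbowKConnected : ∀ {K k} → Separating h K → k ≤ (ℓ ∸ 1) * 2 → k ≤ suc (K * r) →
                      RainbowKConnected (KAdj ℓ r) colouring k
  rainbowKConnected S k≤2[ℓ-1] k≤1+Kr (i , a) (j , b) u≢v with i ≟ j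
  ... | yes refl = RainbowPaths-mono k≤2[ℓ-1]
                     (pathsThrough adj⇒≢ colouring u≢v (samePartMiddles (u≢v ∘ cong (i ,_))))
  ... | no  i≢j  = RainbowPaths-mono k≤1+Kr
                     (pathsThroughAndEdge adj⇒≢ colouring i≢j (differentPartMiddles {a = a} {b} S i≢j))

Kℓ[r]-rainbowConnected⇒2≤colours : ∀ {ℓ r k j} → 2 ≤ ℓ → 1 ≤ r → 2 ≤ k →
  (c : EdgeColouring (KAdj ℓ r) j) → RainbowKConnected (KAdj ℓ r) c k → 2 ≤ j
Kℓ[r]-rainbowConnected⇒2≤colours {suc (suc _)} {suc _} (s≤s (s≤s z≤n)) (s≤s z≤n) =
  rainbowConnected⇒2≤colours {u = zero , zero} {suc zero , zero} λ ()

-- The rook's graph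

-- Part x sits in row x / L and column x % L; the rows from L on may be incomplete.
module Rook (n ℓ : ℕ) where

  L : ℕ
  L = 3 + n

  row col : Fin ℓ → ℕ
  row x = toℕ x / L
  col x = toℕ x % L

  sameLine : Fin ℓ → Fin ℓ → Bool
  sameLine x y = does (row x ≟ℕ row y) ∨ does (col x ≟ℕ col y)

  sameLine-sym : ∀ x y → sameLine x y ≡ sameLine y x
  sameLine-sym x y = cong₂ _∨_ (does-≟-sym _≟ℕ_ (row x) (row y)) (does-≟-sym _≟ℕ_ (col x) (col y))

  sameLine-row : ∀ x y → row x ≡ row y → sameLine x y ≡ true
  sameLine-row x y e rewrite dec-true (row x ≟ℕ row y) e = refl

  sameLine-col : ∀ x y → col x ≡ col y → sameLine x y ≡ true
  sameLine-col x y e rewrite dec-true (col x ≟ℕ col y) e = ∨-zeroʳ _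

  sameLine-neither : ∀ x y {p c} → row x ≡ p → col x ≡ c → p ≢ row y → c ≢ col y → sameLine x y ≡ false
  sameLine-neither x y refl refl p≢ c≢
    rewrite dec-false (row x ≟ℕ row y) p≢ | dec-false (col x ≟ℕ col y) c≢ = refl

  col<L : ∀ x → col x < L
  col<L x = m%n<n (toℕ x) L

  toℕ≡col+row*L : ∀ x → toℕ x ≡ col x + row x * L
  toℕ≡col+row*L x = m≡m%n+[m/n]*n (toℕ x) L

  row-col-injective : ∀ {x y} → row x ≡ row y → col x ≡ col y → x ≡ y
  row-col-injective {x} {y} r≡ c≡ = toℕ-injective (begin
    toℕ x             ≡⟨ toℕ≡col+row*L x ⟩
    col x + row x * L ≡⟨ cong₂ (λ c p → c + p * L) c≡ r≡ ⟩
    col y + row y * L ≡⟨ toℕ≡col+row*L y ⟨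
    toℕ y             ∎)
    where open ≡-Reasoning

  cell : (c p : ℕ) → c + p * L < ℓ → Fin ℓ
  cell c p c+pL<ℓ = fromℕ< c+pL<ℓ

  col-cell : ∀ c p (b : c + p * L < ℓ) → c < L → col (cell c p b) ≡ c
  col-cell c p b c<L = begin
    toℕ (fromℕ< b) % L ≡⟨ cong (_% L) (toℕ-fromℕ< b) ⟩
    (c + p * L) % L    ≡⟨ [m+kn]%n≡m%n c p L ⟩
    c % L              ≡⟨ m<n⇒m%n≡m c<L ⟩
    c                  ∎
    where open ≡-Reasoning

  row-cell : ∀ c p (b : c + p * L < ℓ) → c < L → row (cell c p b) ≡ p
  row-cell c p b c<L = begin
    toℕ (fromℕ< b) / L ≡⟨ cong (_/ L) (toℕ-fromℕ< b) ⟩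
    (c + p * L) / L    ≡⟨ +-distrib-/-∣ʳ c (n∣m*n p) ⟩
    c / L + p * L / L  ≡⟨ cong₂ _+_ (m<n⇒m/n≡0 c<L) (m*n/n≡m p L) ⟩
    p                  ∎
    where open ≡-Reasoning

  avoid₂-<L : ∀ x y (t : Fin (suc n)) → avoid₂ x y (toℕ t) < L
  avoid₂-<L x y t = ≤-<-trans (avoid₂-≤ x y (toℕ t)) (s≤s (s≤s (toℕ<n t)))

  avoid₂-Fin-injective : ∀ x y {s t : Fin (suc n)} → avoid₂ x y (toℕ s) ≡ avoid₂ x y (toℕ t) → s ≡ t
  avoid₂-Fin-injective x y = toℕ-injective ∘ avoid₂-injective x y

  ≢-viaRow : ∀ {m x p} → row m ≡ p → p ≢ row x → m ≢ x
  ≢-viaRow refl p≢ = p≢ ∘ cong row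

  ≢-viaCol : ∀ {m x c} → col m ≡ c → c ≢ col x → m ≢ x
  ≢-viaCol refl c≢ = c≢ ∘ cong col

  true≢false : ∀ {a b : Bool} → a ≡ true → b ≡ false → a ≢ b
  true≢false refl refl ()

  module _ (L²≤ℓ : L * L ≤ ℓ) where

    inGrid : ∀ c p → c < L → p < L → c + p * L < ℓ
    inGrid c p c<L p<L = begin-strict
      c + p * L     <⟨ +-monoˡ-< (p * L) c<L ⟩
      suc p * L     ≤⟨ *-monoˡ-≤ L p<L ⟩
      L * L         ≤⟨ L²≤ℓ ⟩
      ℓ             ∎
      where open ≤-Reasoning

    alongColumn : ∀ {i j} → col i ≢ col j →
                  AtLeast (suc n) (λ m → m ≢ i × m ≢ j × sameLine m i ≢ sameLine m j)
    alongColumn {i} {j} ci≢cj = record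
      { pick           = pick′
      ; pick-injective = λ e → avoid₂-Fin-injective (row i) (row j)
                                 (trans (sym (row-pick _)) (trans (cong row e) (row-pick _)))
      ; pick-satisfies = λ t →
          ≢-viaRow (row-pick t) (ρ≢ri t) , ≢-viaRow (row-pick t) (ρ≢rj t) ,
          true≢false (sameLine-col (pick′ t) i (col-pick t))
                     (sameLine-neither (pick′ t) j (row-pick t) (col-pick t) (ρ≢rj t) ci≢cj)
      }
      where
      ρ : Fin (suc n) → ℕ
      ρ t = avoid₂ (row i) (row j) (toℕ t)
      ρ≢ri : ∀ t → ρ t ≢ row i
      ρ≢ri t = avoid₂-≢ˡ (row i) (row j) (toℕ t)
      ρ≢rj : ∀ t → ρ t ≢ row j
      ρ≢rj t = avoid₂-≢ʳ (row i) (row j) (toℕ t)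
      bound : ∀ t → col i + ρ t * L < ℓ
      bound t = inGrid (col i) (ρ t) (col<L i) (avoid₂-<L (row i) (row j) t)
      pick′ : Fin (suc n) → Fin ℓ
      pick′ t = cell (col i) (ρ t) (bound t)
      row-pick : ∀ t → row (pick′ t) ≡ ρ t
      row-pick t = row-cell (col i) (ρ t) (bound t) (col<L i)
      col-pick : ∀ t → col (pick′ t) ≡ col i
      col-pick t = col-cell (col i) (ρ t) (bound t) (col<L i)

    -- A row above another part's row is complete.
    alongRow : ∀ {i j} → row i < row j → col i ≡ col j →
               AtLeast (suc n) (λ m → m ≢ i × m ≢ j × sameLine m i ≢ sameLine m j)
    alongRow {i} {j} ri<rj ci≡cj = record
      { pick           = pick′
      ; pick-injective = λ e → avoid₂-Fin-injective (col i) (col i)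
                                 (trans (sym (col-pick _)) (trans (cong col e) (col-pick _)))
      ; pick-satisfies = λ t →
          ≢-viaCol (col-pick t) (γ≢ci t) , ≢-viaRow (row-pick t) (<⇒≢ ri<rj) ,
          true≢false (sameLine-row (pick′ t) i (row-pick t))
                     (sameLine-neither (pick′ t) j (row-pick t) (col-pick t) (<⇒≢ ri<rj)
                                       (subst (γ t ≢_) ci≡cj (γ≢ci t)))
      }
      where
      γ : Fin (suc n) → ℕ
      γ t = avoid₂ (col i) (col i) (toℕ t)
      γ≢ci : ∀ t → γ t ≢ col i
      γ≢ci t = avoid₂-≢ˡ (col i) (col i) (toℕ t)
      bound : ∀ t → γ t + row i * L < ℓ
      bound t = begin-strict
        γ t + row i * L   <⟨ +-monoˡ-< (row i * L) (avoid₂-<L (col i) (col i) t) ⟩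
        suc (row i) * L   ≤⟨ *-monoˡ-≤ L ri<rj ⟩
        row j * L         ≤⟨ m≤n+m (row j * L) (col j) ⟩
        col j + row j * L ≡⟨ toℕ≡col+row*L j ⟨
        toℕ j             <⟨ toℕ<n j ⟩
        ℓ                 ∎
        where open ≤-Reasoning
      pick′ : Fin (suc n) → Fin ℓ
      pick′ t = cell (γ t) (row i) (bound t)
      row-pick : ∀ t → row (pick′ t) ≡ row i
      row-pick t = row-cell (γ t) (row i) (bound t) (avoid₂-<L (col i) (col i) t)
      col-pick : ∀ t → col (pick′ t) ≡ γ t
      col-pick t = col-cell (γ t) (row i) (bound t) (avoid₂-<L (col i) (col i) t)

    offLines : ∀ i j → AtLeast (suc n) (λ m → m ≢ i × m ≢ j × sameLine m i ≡ sameLine m j)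
    offLines i j = record
      { pick           = pick′
      ; pick-injective = λ e → avoid₂-Fin-injective (col i) (col j)
                                 (trans (sym (col-pick _)) (trans (cong col e) (col-pick _)))
      ; pick-satisfies = λ t →
          ≢-viaRow (row-pick t) p₀≢ri , ≢-viaRow (row-pick t) p₀≢rj ,
          trans (sameLine-neither (pick′ t) i (row-pick t) (col-pick t) p₀≢ri (γ≢ci t))
                (sym (sameLine-neither (pick′ t) j (row-pick t) (col-pick t) p₀≢rj (γ≢cj t)))
      }
      where
      p₀ : ℕ
      p₀ = avoid₂ (row i) (row j) 0
      p₀≢ri : p₀ ≢ row i
      p₀≢ri = avoid₂-≢ˡ (row i) (row j) 0
      p₀≢rj : p₀ ≢ row j
      p₀≢rj = avoid₂-≢ʳ (row i) (row j) 0
      γ : Fin (suc n) → ℕ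
      γ t = avoid₂ (col i) (col j) (toℕ t)
      γ≢ci : ∀ t → γ t ≢ col i
      γ≢ci t = avoid₂-≢ˡ (col i) (col j) (toℕ t)
      γ≢cj : ∀ t → γ t ≢ col j
      γ≢cj t = avoid₂-≢ʳ (col i) (col j) (toℕ t)
      γ<L : ∀ t → γ t < L
      γ<L = avoid₂-<L (col i) (col j)
      bound : ∀ t → γ t + p₀ * L < ℓ
      bound t = inGrid (γ t) p₀ (γ<L t) (avoid₂-<L (row i) (row j) zero)
      pick′ : Fin (suc n) → Fin ℓ
      pick′ t = cell (γ t) p₀ (bound t)
      row-pick : ∀ t → row (pick′ t) ≡ p₀
      row-pick t = row-cell (γ t) p₀ (bound t) (γ<L t)
      col-pick : ∀ t → col (pick′ t) ≡ γ t
      col-pick t = col-cell (γ t) p₀ (bound t) (γ<L t)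

    separating : Separating sameLine (suc n)
    separating = record { distinguishing = distinguishing ; agreeing = λ {i} {j} _ → offLines i j }
      where
      distinguishing : ∀ {i j} → i ≢ j →
                       AtLeast (suc n) (λ m → m ≢ i × m ≢ j × sameLine m i ≢ sameLine m j)
      distinguishing {i} {j} i≢j with col i ≟ℕ col j | <-cmp (row i) (row j)
      ... | no  ci≢cj | _             = alongColumn ci≢cj
      ... | yes ci≡cj | tri< ri<rj _ _ = alongRow ri<rj ci≡cj
      ... | yes ci≡cj | tri≈ _ ri≡rj _ = ⊥-elim (i≢j (row-col-injective ri≡rj ci≡cj))
      ... | yes ci≡cj | tri> _ _ rj<ri =
        AtLeast-map (λ (m≢j , m≢i , separates) → m≢i , m≢j , separates ∘ sym)
                    (alongRow rj<ri (sym ci≡cj))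

rc-Kℓ[r]≡2 : ∀ {L ℓ r k} → 3 ≤ L → L * L ≤ ℓ → 1 ≤ r → 2 ≤ k →
             k ≤ (ℓ ∸ 1) * 2 → k ≤ suc ((L ∸ 2) * r) → RcEquals (KAdj ℓ r) k 2
rc-Kℓ[r]≡2 {suc (suc (suc n))} {ℓ} (s≤s (s≤s (s≤s _))) L²≤ℓ r≥1 k≥2 k≤2[ℓ-1] k≤1+Kr =
  (colouring , rainbowKConnected (separating L²≤ℓ) k≤2[ℓ-1] k≤1+Kr) ,
  λ j j<2 (c , connected) → <⇒≱ j<2 (Kℓ[r]-rainbowConnected⇒2≤colours 2≤ℓ r≥1 k≥2 c connected)
  where
  open Rook n ℓ
  open Multipartite sameLine sameLine-sym
  2≤ℓ : 2 ≤ ℓ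
  2≤ℓ = ≤-trans (s≤s (s≤s z≤n)) L²≤ℓ

-- The threshold ℓ₀

least-satisfies : ∀ (P : ℕ → Set) P? bound → P bound → P (least P P? bound)
least-satisfies P P? bound = leastFrom-satisfies bound 0 ∘ subst P (sym (+-identityʳ bound))
  where
  leastFrom-satisfies : ∀ fuel n → P (fuel + n) → P (leastFrom P P? fuel n)
  leastFrom-satisfies zero       n p = p
  leastFrom-satisfies (suc fuel) n p with P? n
  ... | yes Pn = Pn
  ... | no  _  = leastFrom-satisfies fuel (suc n) (subst P (sym (+-suc fuel n)) p)

n≤2n² : ∀ n → n ≤ 2 * (n * n)
n≤2n² zero        = z≤n
n≤2n² n@(suc _)   = m≤n⇒m≤o*n 2 (m≤m*n n n)

ceilSqrtHalfPlusOne-spec : ∀ k → k + 2 ≤ 2 * (ceilSqrtHalfPlusOne k * ceilSqrtHalfPlusOne k)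
ceilSqrtHalfPlusOne-spec k =
  least-satisfies (λ n → k + 2 ≤ 2 * (n * n)) (λ n → k + 2 ≤? 2 * (n * n)) (k + 2) (n≤2n² (k + 2))

ceilDiv-spec : ∀ m r .{{_ : NonZero r}} → m ≤ r * ceilDiv m r
ceilDiv-spec m r = least-satisfies (λ n → m ≤ r * n) (λ n → m ≤? r * n) m (m≤n*m m r)

module _ (k r : ℕ) .{{_ : NonZero r}} where

  private
    S C : ℕ
    S = ceilSqrtHalfPlusOne k
    C = ceilDiv (k ∸ 1) r

  k+2≤2ℓ₀² : k + 2 ≤ 2 * (ℓ₀ k r * ℓ₀ k r)
  k+2≤2ℓ₀² = ≤-trans (ceilSqrtHalfPlusOne-spec k) (*-monoʳ-≤ 2 (*-mono-≤ S≤ℓ₀ S≤ℓ₀))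
    where
    S≤ℓ₀ : S ≤ ℓ₀ k r
    S≤ℓ₀ = m≤m⊔n S (C + 2)

  k∸1≤r[ℓ₀∸2] : k ∸ 1 ≤ r * (ℓ₀ k r ∸ 2)
  k∸1≤r[ℓ₀∸2] = ≤-trans (ceilDiv-spec (k ∸ 1) r) (*-monoʳ-≤ r C≤ℓ₀∸2)
    where
    C≤ℓ₀∸2 : C ≤ ℓ₀ k r ∸ 2
    C≤ℓ₀∸2 = subst (_≤ ℓ₀ k r ∸ 2) (m+n∸n≡m C 2) (∸-monoˡ-≤ 2 (m≤n⊔m S (C + 2)))

  3≤ℓ₀ : 2 ≤ k → 3 ≤ ℓ₀ k r
  3≤ℓ₀ k≥2 = ≤-trans (+-monoˡ-≤ 2 1≤C) (m≤n⊔m S (C + 2))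
    where
    1≤C : 1 ≤ C
    1≤C = n≢0⇒n>0 λ C≡0 → <⇒≱ (∸-monoˡ-≤ 1 k≥2)
      (subst (k ∸ 1 ≤_) (trans (cong (r *_) C≡0) (*-zeroʳ r)) (ceilDiv-spec (k ∸ 1) r))

k+2≤2ℓ⇒k≤[ℓ∸1]*2 : ∀ {k ℓ} → k + 2 ≤ 2 * ℓ → k ≤ (ℓ ∸ 1) * 2
k+2≤2ℓ⇒k≤[ℓ∸1]*2 {k} {ℓ} k+2≤2ℓ = begin
  k               ≡⟨ m+n∸n≡m k 2 ⟨
  k + 2 ∸ 2       ≤⟨ ∸-monoˡ-≤ 2 k+2≤2ℓ ⟩
  2 * ℓ ∸ 2       ≡⟨ cong (_∸ 2) (*-comm 2 ℓ) ⟩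
  ℓ * 2 ∸ 1 * 2   ≡⟨ *-distribʳ-∸ 2 ℓ 1 ⟨
  (ℓ ∸ 1) * 2     ∎
  where open ≤-Reasoning

theorem3 : (r k : ℕ) → 1 ≤ r → 2 ≤ k →
    (ℓ : ℕ) → ℓ₀ k r * ℓ₀ k r ≤ ℓ →
    RcEquals (KAdj ℓ r) k 2
theorem3 r k r≥1 k≥2 ℓ ℓ₀²≤ℓ = rc-Kℓ[r]≡2 (3≤ℓ₀ k r k≥2) ℓ₀²≤ℓ r≥1 k≥2 k≤[ℓ∸1]*2 k≤1+[ℓ₀∸2]r
  where
  instance
    r≢0 : NonZero r
    r≢0 = >-nonZero r≥1
  k≤[ℓ∸1]*2 : k ≤ (ℓ ∸ 1) * 2
  k≤[ℓ∸1]*2 = k+2≤2ℓ⇒k≤[ℓ∸1]*2 {k} {ℓ} (≤-trans (k+2≤2ℓ₀² k r) (*-monoʳ-≤ 2 ℓ₀²≤ℓ))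
  k≤1+[ℓ₀∸2]r : k ≤ suc ((ℓ₀ k r ∸ 2) * r)
  k≤1+[ℓ₀∸2]r = ≤-trans (m≤n+m∸n k 1) (s≤s (subst (k ∸ 1 ≤_) (*-comm r _) (k∸1≤r[ℓ₀∸2] k r)))
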